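{- Let $V=\{p_0,\ldots,p_n\}$. For every BDD $\Omega$ over $V\cup V'$ and all $s,t\subseteq V$: $s\xrightarrow{\tau_0(\Omega)}t$ if and only if $s\cup t'\vDash\Omega$.
   Context: $V=\{p_0,\ldots,p_n\}$ is ordered $p_0<\dots<p_n$; $V'=\{p_0',\ldots,p_n'\}$ is a fresh copy and $t'=\{p'\mid p\in t\}$. BDDs over $V\cup V'$ are reduced ordered binary decision diagrams w.r.t. $p_0<p_0'<p_1<p_1'<\dots<p_n<p_n'$, representing Boolean functions on subsets of $V\cup V'$; leaves are $\top,\bot$; $(t_0\dashleftarrow(q)\rightarrow t_1)$ is an inner node labelled $q$ with else-child $t_0$ and then-child $t_1$. Mental programs over $V$: $\pi::=p\leftarrow\top\mid p\leftarrow\bot\mid\beta?\mid\pi\cup\pi\mid\pi;\pi\mid\pi\cap\pi$; for $s,t\subseteq V$: $s\xrightarrow{p\leftarrow\top}t$ iff $t=s\cup\{p\}$; $s\xrightarrow{p\leftarrow\bot}t$ iff $t=s\setminus\{p\}$; $s\xrightarrow{\beta?}t$ iff $s=t$ and $s\vDash\beta$; $\cup,\cap$ union/intersection of relations; $;$ relational composition ($s\xrightarrow{\pi_1;\pi_2}t$ iff some $u\subseteq V$ has $s\xrightarrow{\pi_1}u\xrightarrow{\pi_2}t$). The function $\tau$: $\tau(\bot,L)=?\bot$; $\tau(\top,[])=?\top$; $\tau(\top,[p_k,\ldots,p_n])=((p_k\leftarrow\bot)\cup(p_k\leftarrow\top));\tau(\top,[p_{k+1},\ldots,p_n])$; for $\Omega=(t_0\dashleftarrow(p_i)\rightarrow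 t_1)$: $\tau(\Omega,[p_k,\ldots,p_n])=(?\neg p_k;\tau(t_0,[p_k,\ldots,p_n]))\cup(?p_k;\tau(t_1,[p_k,\ldots,p_n]))$ if $i=k$, and $((p_k\leftarrow\bot)\cup(p_k\leftarrow\top));\tau(\Omega,[p_{k+1},\ldots,p_n])$ otherwise; for $\Omega=(t_0\dashleftarrow(p_i')\rightarrow t_1)$: $\tau(\Omega,[p_k,\ldots,p_n])=(p_k\leftarrow\bot;\tau(t_0,[p_{k+1},\ldots,p_n]))\cup(p_k\leftarrow\top;\tau(t_1,[p_{k+1},\ldots,p_n]))$ if $i=k$, and $((p_k\leftarrow\bot)\cup(p_k\leftarrow\top));\tau(\Omega,[p_{k+1},\ldots,p_n])$ otherwise. Finally $\tau_0(\Omega):=\tau(\Omega,[p_0,\ldots,p_n])$. -}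

module Defs where

open import Data.Nat using (ℕ; zero; suc; _+_; _*_; _≤_)
open import Data.Fin using (Fin; toℕ; _≟_)
open import Data.Fin.Subset using (Subset; _∪_; _-_; ⁅_⁆)
open import Data.Vec using (lookup)
open import Data.Bool using (Bool; true; false; not; _∧_; _∨_; if_then_else_)
open import Data.List using (List; []; _∷_)
open import Data.List using (allFin) public
open import Data.Product using (Σ; _×_)
open import Data.Sum using (_⊎_)
open import Relation.Binary.PropositionalEquality using (_≡_)
open import Relation.Nullary using (¬_; yes; no)
open import Relation.Nullary.Decidable using (⌊_⌋)

-- V = {p_0,…,p_n} is represented by Fin (suc n); subsets of V by Subset (suc n).

data Var (n : ℕ) : Set where
  unp : Fin (suc n) → Var n
  pr  : Fin (suc n) → Var n

-- position in the order p_0 < p_0' < p_1 < p_1' < … < p_n < p_n'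
rank : {n : ℕ} → Var n → ℕ
rank (unp i) = 2 * toℕ i
rank (pr i)  = suc (2 * toℕ i)

-- decision diagrams: leaves ⊤, ⊥; node q t0 t1 = (t0 ⇠(q)→ t1), t0 else-child, t1 then-child
data BDD (n : ℕ) : Set where
  leaf⊤ : BDD n
  leaf⊥ : BDD n
  node  : Var n → BDD n → BDD n → BDD n

OrderedFrom : {n : ℕ} → ℕ → BDD n → Set
OrderedFrom b leaf⊤ = Data.Unit.⊤ where import Data.Unit
OrderedFrom b leaf⊥ = Data.Unit.⊤ where import Data.Unit
OrderedFrom b (node q t0 t1) = (b ≤ rank q) × OrderedFrom (suc (rank q)) t0 × OrderedFrom (suc (rank q)) t1

Ordered : {n : ℕ} → BDD n → Set
Ordered = OrderedFrom 0

-- reduced (tree representation; sharing of isomorphic subgraphs is implicit):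
-- no node has identical children
Reduced : {n : ℕ} → BDD n → Set
Reduced leaf⊤ = Data.Unit.⊤ where import Data.Unit
Reduced leaf⊥ = Data.Unit.⊤ where import Data.Unit
Reduced (node q t0 t1) = ¬ (t0 ≡ t1) × Reduced t0 × Reduced t1

IsROBDD : {n : ℕ} → BDD n → Set
IsROBDD Ω = Ordered Ω × Reduced Ω

-- the subset s ∪ t' of V ∪ V', as a valuation of Var n
_∪′_ : {n : ℕ} → Subset (suc n) → Subset (suc n) → Var n → Bool
(s ∪′ t) (unp i) = lookup s i
(s ∪′ t) (pr i)  = lookup t i

evalBDD : {n : ℕ} → BDD n → (Var n → Bool) → Bool
evalBDD leaf⊤ ρ = true
evalBDD leaf⊥ ρ = false
evalBDD (node q t0 t1) ρ = if ρ q then evalBDD t1 ρ else evalBDD t0 ρ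

_⊨BDD_ : {n : ℕ} → (Var n → Bool) → BDD n → Set
ρ ⊨BDD Ω = evalBDD Ω ρ ≡ true

data Form (n : ℕ) : Set where
  ⊤f ⊥f : Form n
  var   : Fin (suc n) → Form n
  ¬f_   : Form n → Form n
  _∧f_ _∨f_ : Form n → Form n → Form n

evalF : {n : ℕ} → Form n → Subset (suc n) → Bool
evalF ⊤f s = true
evalF ⊥f s = false
evalF (var p) s = lookup s p
evalF (¬f β) s = not (evalF β s)
evalF (β ∧f γ) s = evalF β s ∧ evalF γ s
evalF (β ∨f γ) s = evalF β s ∨ evalF γ s

_⊨_ : {n : ℕ} → Subset (suc n) → Form n → Set
s ⊨ β = evalF β s ≡ true

data Prog (n : ℕ) : Set where
  _←⊤ _←⊥ : Fin (suc n) → Prog n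
  _¿      : Form n → Prog n
  _∪p_ _⨾_ _∩p_ : Prog n → Prog n → Prog n

infix 8 _¿
infixr 6 _⨾_
infixr 5 _∪p_ _∩p_

Step : {n : ℕ} → Prog n → Subset (suc n) → Subset (suc n) → Set
Step (p ←⊤) s t = t ≡ s ∪ ⁅ p ⁆
Step (p ←⊥) s t = t ≡ s - p
Step (β ¿) s t = (s ≡ t) × (s ⊨ β)
Step (π₁ ∪p π₂) s t = Step π₁ s t ⊎ Step π₂ s t
Step (π₁ ⨾ π₂) s t = Σ (Subset _) λ u → Step π₁ s u × Step π₂ u t
Step (π₁ ∩p π₂) s t = Step π₁ s t × Step π₂ s t

choose : {n : ℕ} → Fin (suc n) → Prog n
choose p = (p ←⊥) ∪p (p ←⊤)

-- the translation τ; the list argument is [p_k,…,p_n]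
τ : {n : ℕ} → BDD n → List (Fin (suc n)) → Prog n
τ leaf⊥ L = ⊥f ¿
τ leaf⊤ [] = ⊤f ¿
τ leaf⊤ (k ∷ L) = choose k ⨾ τ leaf⊤ L
τ (node q t0 t1) [] = ⊥f ¿   -- case not covered by the paper (unreachable for ordered Ω)
τ (node (unp i) t0 t1) (k ∷ L) =
  if ⌊ i ≟ k ⌋
  then (((¬f var k) ¿ ⨾ τ t0 (k ∷ L)) ∪p ((var k) ¿ ⨾ τ t1 (k ∷ L)))
  else (choose k ⨾ τ (node (unp i) t0 t1) L)
τ (node (pr i) t0 t1) (k ∷ L) =
  if ⌊ i ≟ k ⌋
  then (((k ←⊥) ⨾ τ t0 L) ∪p ((k ←⊤) ⨾ τ t1 L))
  else (choose k ⨾ τ (node (pr i) t0 t1) L)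

τ₀ : {n : ℕ} → BDD n → Prog n
τ₀ {n} Ω = τ Ω (allFin (suc n))

-- τ(Ω, [p_k,…,p_n]) leaves p_0,…,p_{k-1} unchanged and relates s to t exactly when
-- s ∪ t' ⊨ Ω, provided every variable of Ω is at least p_k in the interleaved order. At a node testing p_k the state still
-- holds the initial value of p_k, because p_k precedes p_k', so the test reads s; at a node
-- testing p_k' the program assigns p_k, fixing the final value t(p_k). A variable p_k that Ω
-- skips is guessed nondeterministically, which is harmless because what remains of Ω no
-- longer mentions p_k, and the guess has to be t(p_k) for the run to end in t.
module Submission where

open import Defs
open import Data.Nat using (ℕ; suc; _+_; _*_; _≤_; _<_; s≤s)
open import Data.Nat.Properties
  using (≤-trans; ≤-reflexive; n≤1+n; n<1+n; 1+n≰n; ≤∧≢⇒<; m<1+n⇒m<n∨m≡n; m<1+n⇒m≤n;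
         <⇒≢; +-identityʳ; +-suc; *-suc; *-monoʳ-≤; *-cancelˡ-≤; *-cancelˡ-<)
open import Data.Fin using (Fin; toℕ; _≟_) renaming (zero to fzero; suc to fsuc)
open import Data.Fin.Properties using (toℕ-injective; toℕ<n; toℕ≤pred[n])
open import Data.Fin.Subset using (Subset; _∪_; _-_; ⁅_⁆)
open import Data.Fin.Subset.Properties using (∪-identityʳ; p─⊥≡p)
open import Data.Vec using (_∷_; lookup; _[_]≔_)
import Data.Vec as Vec
open import Data.Vec.Properties using (lookup∘update; lookup∘update′; tabulate∘lookup; tabulate-cong)
open import Data.Bool using (Bool; true; false; if_then_else_)
open import Data.Bool.Properties using (∨-zeroʳ; ∨-identityʳ)
open import Data.List using (List; []; _∷_; tabulate)
open import Data.Product using (Σ; _×_; _,_; proj₂)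
open import Data.Product.Algebra using (×-assoc)
open import Data.Product.Function.NonDependent.Propositional using (_×-⇔_)
open import Data.Sum using (_⊎_; inj₁; inj₂)
open import Data.Sum.Function.Propositional using (_⊎-⇔_)
open import Data.Empty using (⊥-elim)
open import Data.Unit using (tt)
open import Function.Bundles using (_⇔_; mk⇔; Equivalence)
open import Function.Properties.Equivalence using () renaming (trans to ⇔-trans)
open import Function.Properties.Inverse using (↔⇒⇔)
open import Function.Related.Propositional using (K-reflexive; module EquationalReasoning)
open import Relation.Binary.PropositionalEquality
open import Relation.Nullary using (¬_; yes; no)

private
  variable
    m n : ℕ
    b : Bool
    s t : Subset m
    p : Fin m
    k : ℕ
    π π₀ π₁ : Prog n
    Ω t₀ t₁ : BDD n

∪⁅⁆≡[]≔true : (s : Subset m) (p : Fin m) → s ∪ ⁅ p ⁆ ≡ s [ p ]≔ true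
∪⁅⁆≡[]≔true (x ∷ s) fzero    = cong₂ _∷_ (∨-zeroʳ x) (∪-identityʳ s)
∪⁅⁆≡[]≔true (x ∷ s) (fsuc p) = cong₂ _∷_ (∨-identityʳ x) (∪⁅⁆≡[]≔true s p)

-≡[]≔false : (s : Subset m) (p : Fin m) → s - p ≡ s [ p ]≔ false
-≡[]≔false (x ∷ s) fzero    = cong (false ∷_) (p─⊥≡p s)
-≡[]≔false (x ∷ s) (fsuc p) = cong (x ∷_) (-≡[]≔false s p)

Agree : ℕ → Subset m → Subset m → Set
Agree k s t = ∀ j → toℕ j < k → lookup s j ≡ lookup t j

Agree-all : {s t : Subset m} → Agree m s t → s ≡ t
Agree-all {s = s} {t} agree = begin
  s                       ≡⟨ tabulate∘lookup s ⟨
  Vec.tabulate (lookup s) ≡⟨ tabulate-cong (λ j → agree j (toℕ<n j)) ⟩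
  Vec.tabulate (lookup t) ≡⟨ tabulate∘lookup t ⟩
  t                       ∎
  where open ≡-Reasoning

Agree-update : Agree (suc (toℕ p)) (s [ p ]≔ b) t ⇔ (lookup t p ≡ b × Agree (toℕ p) s t)
Agree-update {p = p} {s = s} {b = b} {t = t} = mk⇔ to from
  where
  below : ∀ {j} → toℕ j < toℕ p → lookup (s [ p ]≔ b) j ≡ lookup s j
  below j<p = lookup∘update′ (λ j≡p → <⇒≢ j<p (cong toℕ j≡p)) s b

  to : Agree (suc (toℕ p)) (s [ p ]≔ b) t → lookup t p ≡ b × Agree (toℕ p) s t
  to agree = trans (sym (agree p (n<1+n _))) (lookup∘update p s b)
           , λ j j<p → trans (sym (below j<p)) (agree j (≤-trans j<p (n≤1+n _)))

  from : lookup t p ≡ b × Agree (toℕ p) s t → Agree (suc (toℕ p)) (s [ p ]≔ b) t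
  from (tp≡b , agree) j j≤p with m<1+n⇒m<n∨m≡n j≤p
  ... | inj₁ j<p = trans (below j<p) (agree j j<p)
  ... | inj₂ j≡p with toℕ-injective j≡p
  ...   | refl = trans (lookup∘update p s b) (sym tp≡b)

_≔_ : Fin (suc n) → Bool → Prog n
p ≔ true  = p ←⊤
p ≔ false = p ←⊥

one-point : {A : Set} {P : A → Set} {x : A} → (Σ A λ y → y ≡ x × P y) ⇔ P x
one-point = mk⇔ (λ { (_ , refl , px) → px }) (λ px → _ , refl , px)

Step-≔⨾ : ∀ b → Step ((p ≔ b) ⨾ π) s t ⇔ Step π (s [ p ]≔ b) t
Step-≔⨾ {p = p} {s = s} true  rewrite ∪⁅⁆≡[]≔true s p = one-point
Step-≔⨾ {p = p} {s = s} false rewrite -≡[]≔false s p = one-point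

Step-∪⨾ : Step ((π₀ ∪p π₁) ⨾ π) s t ⇔ (Step (π₀ ⨾ π) s t ⊎ Step (π₁ ⨾ π) s t)
Step-∪⨾ = mk⇔ (λ { (u , inj₁ st₀ , st) → inj₁ (u , st₀ , st) ; (u , inj₂ st₁ , st) → inj₂ (u , st₁ , st) })
              (λ { (inj₁ (u , st₀ , st)) → u , inj₁ st₀ , st ; (inj₂ (u , st₁ , st)) → u , inj₂ st₁ , st })

Step-test-branch : (P : Bool → Set) → Step π₀ s t ⇔ P false → Step π₁ s t ⇔ P true →
                   Step (((¬f var p) ¿ ⨾ π₀) ∪p ((var p) ¿ ⨾ π₁)) s t ⇔ P (lookup s p)
Step-test-branch {s = s} {p = p} P st₀ st₁ with lookup s p
... | false = mk⇔ (λ { (inj₁ (_ , (refl , _) , st)) → Equivalence.to st₀ st ; (inj₂ (_ , (_ , ()) , _)) })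
                  (λ P₀ → inj₁ (s , (refl , refl) , Equivalence.from st₀ P₀))
... | true  = mk⇔ (λ { (inj₁ (_ , (_ , ()) , _)) ; (inj₂ (_ , (refl , _) , st)) → Equivalence.to st₁ st })
                  (λ P₁ → inj₂ (s , (refl , refl) , Equivalence.from st₁ P₁))

⊎-select : (x : Bool) (P : Bool → Set) → ((x ≡ false × P false) ⊎ (x ≡ true × P true)) ⇔ P x
⊎-select x P = mk⇔ (λ { (inj₁ (refl , P₀)) → P₀ ; (inj₂ (refl , P₁)) → P₁ }) (select x)
  where
  select : (x : Bool) → P x → (x ≡ false × P false) ⊎ (x ≡ true × P true)
  select false P₀ = inj₁ (refl , P₀)
  select true  P₁ = inj₂ (refl , P₁)

index : Var n → Fin (suc n)
index (unp i) = i
index (pr i)  = i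

2*≤rank⇒≤index : ∀ k (q : Var n) → 2 * k ≤ rank q → k ≤ toℕ (index q)
2*≤rank⇒≤index k (unp i) 2k≤2i   = *-cancelˡ-≤ 2 2k≤2i
2*≤rank⇒≤index k (pr i)  2k≤2i+1 =
  m<1+n⇒m≤n (*-cancelˡ-< 2 k (suc (toℕ i)) (subst (2 * k <_) (sym (*-suc 2 (toℕ i))) (s≤s 2k≤2i+1)))

≤index⇒2*≤rank : ∀ k (q : Var n) → k ≤ toℕ (index q) → 2 * k ≤ rank q
≤index⇒2*≤rank k (unp i) k≤i = *-monoʳ-≤ 2 k≤i
≤index⇒2*≤rank k (pr i)  k≤i = ≤-trans (*-monoʳ-≤ 2 k≤i) (n≤1+n _)

OrderedFrom-weaken : ∀ {b b′} (Ω : BDD n) → b ≤ b′ → OrderedFrom b′ Ω → OrderedFrom b Ω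
OrderedFrom-weaken leaf⊤          _    _               = tt
OrderedFrom-weaken leaf⊥          _    _               = tt
OrderedFrom-weaken (node q t₀ t₁) b≤b′ (b′≤q , o₀ , o₁) = ≤-trans b≤b′ b′≤q , o₀ , o₁

OrderedFrom-skip : ∀ (q : Var n) {t₀ t₁} → OrderedFrom (2 * toℕ p) (node q t₀ t₁) → index q ≢ p →
                   OrderedFrom (2 * suc (toℕ p)) (node q t₀ t₁)
OrderedFrom-skip {p = p} q (p≤q , o₀ , o₁) q≢p =
  ≤index⇒2*≤rank _ q (≤∧≢⇒< (2*≤rank⇒≤index _ q p≤q) (λ p≡q → q≢p (toℕ-injective (sym p≡q)))) , o₀ , o₁

OrderedFrom-past-end : ∀ (q : Var n) {t₀ t₁} → ¬ OrderedFrom (2 * suc n) (node q t₀ t₁)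
OrderedFrom-past-end q (n<q , _) = 1+n≰n (≤-trans (2*≤rank⇒≤index _ q n<q) (toℕ≤pred[n] (index q)))

evalBDD-cong : ∀ {b} (Ω : BDD n) → OrderedFrom b Ω → {ρ ρ′ : Var n → Bool} →
               (∀ q → b ≤ rank q → ρ q ≡ ρ′ q) → evalBDD Ω ρ ≡ evalBDD Ω ρ′
evalBDD-cong leaf⊤ _ _ = refl
evalBDD-cong leaf⊥ _ _ = refl
evalBDD-cong (node q t₀ t₁) (b≤q , o₀ , o₁) {ρ} {ρ′} ρ≗ρ′ =
  trans (cong (λ c → if c then evalBDD t₁ ρ else evalBDD t₀ ρ) (ρ≗ρ′ q b≤q))
        (cong₂ (if ρ′ q then_else_) (evalBDD-cong t₁ o₁ below) (evalBDD-cong t₀ o₀ below))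
  where
  below : ∀ q′ → suc (rank q) ≤ rank q′ → ρ q′ ≡ ρ′ q′
  below q′ q<q′ = ρ≗ρ′ q′ (≤-trans (≤-trans b≤q (n≤1+n _)) q<q′)

evalBDD-update : OrderedFrom (2 * suc (toℕ p)) Ω → evalBDD Ω ((s [ p ]≔ b) ∪′ t) ≡ evalBDD Ω (s ∪′ t)
evalBDD-update {p = p} {Ω = Ω} {s = s} {b = b} o = evalBDD-cong Ω o untouched
  where
  untouched : ∀ q → 2 * suc (toℕ p) ≤ rank q → ((s [ p ]≔ b) ∪′ _) q ≡ (s ∪′ _) q
  untouched (unp j) p<j = lookup∘update′ (λ { refl → 1+n≰n (2*≤rank⇒≤index _ (unp j) p<j) }) s b
  untouched (pr j)  _   = refl

Represents : ℕ → Prog n → BDD n → Set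
Represents k π Ω = ∀ s t → Step π s t ⇔ (Agree k s t × (s ∪′ t) ⊨BDD Ω)

unp-correct : Represents k π₀ t₀ → Represents k π₁ t₁ →
              Represents k (((¬f var p) ¿ ⨾ π₀) ∪p ((var p) ¿ ⨾ π₁)) (node (unp p) t₀ t₁)
unp-correct {k = k} {t₀ = t₀} {t₁ = t₁} correct₀ correct₁ s t =
  Step-test-branch (λ c → Agree k s t × (if c then evalBDD t₁ (s ∪′ t) else evalBDD t₀ (s ∪′ t)) ≡ true)
                   (correct₀ s t) (correct₁ s t)

module _ (Ω : BDD n) (p : Fin (suc n)) (Ω-above-p : OrderedFrom (2 * suc (toℕ p)) Ω)
         (correct : Represents (suc (toℕ p)) π Ω) where

  assign-correct : ∀ b s t → Step ((p ≔ b) ⨾ π) s t ⇔ (lookup t p ≡ b × Agree (toℕ p) s t × (s ∪′ t) ⊨BDD Ω)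
  assign-correct b s t = begin
    Step ((p ≔ b) ⨾ π) s t
      ∼⟨ Step-≔⨾ b ⟩
    Step π (s [ p ]≔ b) t
      ∼⟨ correct (s [ p ]≔ b) t ⟩
    (Agree (suc (toℕ p)) (s [ p ]≔ b) t × ((s [ p ]≔ b) ∪′ t) ⊨BDD Ω)
      ∼⟨ Agree-update {s = s} {t = t} ×-⇔ K-reflexive (cong (_≡ true) (evalBDD-update Ω-above-p)) ⟩
    ((lookup t p ≡ b × Agree (toℕ p) s t) × (s ∪′ t) ⊨BDD Ω)
      ∼⟨ ↔⇒⇔ (×-assoc _ _ _ _) ⟩
    (lookup t p ≡ b × Agree (toℕ p) s t × (s ∪′ t) ⊨BDD Ω)
      ∎
    where open EquationalReasoning

  choose-correct : Represents (toℕ p) (choose p ⨾ π) Ω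
  choose-correct s t =
    ⇔-trans (Step-∪⨾ {π₀ = p ←⊥} {π₁ = p ←⊤})
            (⇔-trans (assign-correct false s t ⊎-⇔ assign-correct true s t)
                     (⊎-select (lookup t p) λ _ → Agree (toℕ p) s t × (s ∪′ t) ⊨BDD Ω))

pr-correct : OrderedFrom (2 * suc (toℕ p)) t₀ → OrderedFrom (2 * suc (toℕ p)) t₁ →
             Represents (suc (toℕ p)) π₀ t₀ → Represents (suc (toℕ p)) π₁ t₁ →
             Represents (toℕ p) (((p ←⊥) ⨾ π₀) ∪p ((p ←⊤) ⨾ π₁)) (node (pr p) t₀ t₁)
pr-correct {p = p} {t₀ = t₀} {t₁ = t₁} o₀ o₁ correct₀ correct₁ s t =
  ⇔-trans (assign-correct t₀ p o₀ correct₀ false s t ⊎-⇔ assign-correct t₁ p o₁ correct₁ true s t)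
          (⊎-select (lookup t p)
                    λ c → Agree (toℕ p) s t × (if c then evalBDD t₁ (s ∪′ t) else evalBDD t₀ (s ∪′ t)) ≡ true)

-- Suffix k L: L = [p_k, …, p_n].
data Suffix {n : ℕ} : ℕ → List (Fin (suc n)) → Set where
  []  : Suffix (suc n) []
  _∷_ : ∀ i {L} → Suffix (suc (toℕ i)) L → Suffix (toℕ i) (i ∷ L)

tabulate-Suffix : ∀ {m} k (f : Fin m → Fin (suc n)) → (∀ j → toℕ (f j) ≡ k + toℕ j) → k + m ≡ suc n →
                  Suffix k (tabulate f)
tabulate-Suffix {m = ℕ.zero} k f _ k+0≡1+n with trans (sym (+-identityʳ k)) k+0≡1+n
... | refl = []
tabulate-Suffix {m = suc m} k f f≡k+ k+1+m≡1+n with trans (f≡k+ fzero) (+-identityʳ k)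
... | refl = f fzero ∷ tabulate-Suffix (suc k) (λ j → f (fsuc j))
                         (λ j → trans (f≡k+ (fsuc j)) (+-suc k (toℕ j)))
                         (trans (sym (+-suc k m)) k+1+m≡1+n)

allFin-Suffix : Suffix 0 (allFin (suc n))
allFin-Suffix = tabulate-Suffix 0 (λ j → j) (λ _ → refl) refl

τ-correct : ∀ {k L} → Suffix k L → (Ω : BDD n) → OrderedFrom (2 * k) Ω → Represents k (τ Ω L) Ω
τ-correct _  leaf⊥ _ s t = mk⇔ (λ { (_ , ()) }) (λ { (_ , ()) })
τ-correct [] leaf⊤ _ s t =
  mk⇔ (λ { (refl , _) → (λ _ _ → refl) , refl }) (λ (agree , _) → Agree-all agree , refl)
τ-correct (k ∷ L) leaf⊤ _ = choose-correct leaf⊤ k tt (τ-correct L leaf⊤ tt)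
τ-correct [] (node q _ _) o = ⊥-elim (OrderedFrom-past-end q o)
-- The recursive calls sit in the with-header: made inside the with-branches, where the
-- suffix is rebuilt as i ∷ L, they would not pass the termination checker.
τ-correct L′@(k ∷ L) Ω@(node (unp i) t₀ t₁) o@(_ , o₀ , o₁)
  with i ≟ k | τ-correct L Ω | τ-correct L′ t₀ | τ-correct L′ t₁
... | no i≢k   | skip | _ | _ = choose-correct Ω k o′ (skip o′)
  where
  o′ : OrderedFrom (2 * suc (toℕ k)) Ω
  o′ = OrderedFrom-skip (unp i) o i≢k
... | yes refl | _ | correct₀ | correct₁ =
  unp-correct {t₀ = t₀} {t₁ = t₁} (correct₀ (OrderedFrom-weaken t₀ (n≤1+n _) o₀))
                                  (correct₁ (OrderedFrom-weaken t₁ (n≤1+n _) o₁))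
τ-correct (k ∷ L) Ω@(node (pr i) t₀ t₁) o@(_ , o₀ , o₁) with i ≟ k
... | no i≢k = choose-correct Ω k o′ (τ-correct L Ω o′)
  where
  o′ : OrderedFrom (2 * suc (toℕ k)) Ω
  o′ = OrderedFrom-skip (pr i) o i≢k
... | yes refl = pr-correct o₀′ o₁′ (τ-correct L t₀ o₀′) (τ-correct L t₁ o₁′)
  where
  o₀′ : OrderedFrom (2 * suc (toℕ i)) t₀
  o₀′ = OrderedFrom-weaken t₀ (≤-reflexive (*-suc 2 (toℕ i))) o₀
  o₁′ : OrderedFrom (2 * suc (toℕ i)) t₁
  o₁′ = OrderedFrom-weaken t₁ (≤-reflexive (*-suc 2 (toℕ i))) o₁

theorem15 : (n : ℕ) (Ω : BDD n) → IsROBDD Ω →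
    (s t : Subset (suc n)) → Step (τ₀ Ω) s t ⇔ ((s ∪′ t) ⊨BDD Ω)
theorem15 n Ω (ordered , _) s t =
  ⇔-trans (τ-correct allFin-Suffix Ω ordered s t) (mk⇔ proj₂ ((λ _ ()) ,_))
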